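{- If $G$ is a finite multigraph and $v\in V(G)$, then $\sum_{u\in N(v)}\frac{\mu(uv)}{d(v)+\mu(uv)}\leq \frac{|N(v)|}{1+|N(v)|}$.
   Context: Multigraphs are loopless and may have parallel edges. $N(v)$ is the set of neighbors of $v$, $\mu(uv)$ is the number of edges joining $u$ and $v$, and $d(v)=\sum_{u\in N(v)}\mu(uv)$. -}

module Defs where

open import Data.Nat using (ℕ; zero; suc; _+_)
open import Data.Fin using (Fin)
open import Data.Integer using (+_)
open import Data.Rational using (ℚ; 0ℚ; _/_)
import Data.Rational as ℚ
open import Data.List using (List; length; filter; map; foldr)
open import Data.List.Base using (allFin)
open import Data.Nat.Properties using (_≟_)
open import Relation.Nullary using (¬?)
open import Relation.Binary.PropositionalEquality using (_≡_)

-- A finite loopless multigraph on vertex set Fin n, given by its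
-- edge-multiplicity function μ (μ u v = number of edges joining u and v).
record Multigraph (n : ℕ) : Set where
  field
    μ        : Fin n → Fin n → ℕ
    symmetric : ∀ u v → μ u v ≡ μ v u
    loopless  : ∀ v → μ v v ≡ 0

open Multigraph public

N : ∀ {n} → Multigraph n → Fin n → List (Fin n)
N G v = filter (λ u → ¬? (μ G u v ≟ 0)) (allFin _)

deg : ∀ {n} → Multigraph n → Fin n → ℕ
deg G v = foldr (λ u s → μ G u v + s) 0 (N G v)

-- the fraction m / (d + m) as a rational; only used for m ≥ 1
-- (written with denominator suc k + d = d + m)
frac : ℕ → ℕ → ℚ
frac zero d = 0ℚ
frac (suc k) d = (+ suc k) / (suc k + d)

sumℚ : List ℚ → ℚ
sumℚ = foldr ℚ._+_ 0ℚ

weightedSum : ∀ {n} → Multigraph n → Fin n → ℚ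
weightedSum G v = sumℚ (map (λ u → frac (μ G u v) (deg G v)) (N G v))

-- Jensen's inequality in tangent-line form: x ↦ x / (x + d) is concave, and its tangent at
-- the mean x = d / k, where the value is 1 / (k + 1), is  t(x) = (d + k² x) / (d (k + 1)²).
-- Bounding each of the k summands by the tangent and summing (Σ μ(uv) = d) gives
-- (k d + k² d) / (d (k + 1)²) = k / (k + 1).
module Submission where

open import Defs
open import Data.Nat as ℕ using (ℕ; zero; suc; _+_; _*_; z≤n; NonZero)
open import Data.Nat.Properties
  using ( ≤-total; ≤-reflexive; m≤n⇒∃[o]m+o≡n; m≤m+n; +-comm; *-zeroʳ; +-monoʳ-≤; +-cancelʳ-≤
        ; m+n≡0⇒m≡0; m+n≡0⇒n≡0)
open import Data.Nat.Tactic.RingSolver using (solve-∀)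
open import Data.Fin using (Fin)
open import Data.Integer as ℤ using (+_; +≤+)
open import Data.Integer.Properties using (pos-+; pos-*; *-distribʳ-+; *-assoc)
open import Data.Rational as ℚ using (ℚ; 0ℚ; _≤_; _/_; toℚᵘ)
open import Data.Rational.Properties
  using (toℚᵘ-cancel-≤; toℚᵘ-fromℚᵘ; toℚᵘ-homo-+; nonNegative⁻¹; normalize-nonNeg)
open import Data.Rational.Unnormalised as ℚᵘ using (ℚᵘ; _≃_; *≤*; *≡*)
  renaming (_/_ to _/ᵘ_; _≤_ to _≤ᵘ_)
open import Data.Rational.Unnormalised.Properties
  using (≃-sym; ≤-respˡ-≃; +-mono-≤; module ≤-Reasoning)
open import Data.List using ([]; _∷_; length; map)
open import Data.Nat.ListAction using (sum)
open import Data.List.Properties using (foldr-map)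
open import Data.Sum using (inj₁; inj₂)
open import Data.Product using (_,_)
open import Relation.Binary.PropositionalEquality

2*m*n≤m*m+n*n-ordered : ∀ {m n} → m ℕ.≤ n → 2 * m * n ℕ.≤ m * m + n * n
2*m*n≤m*m+n*n-ordered {m} m≤n with m≤n⇒∃[o]m+o≡n m≤n
... | t , refl = subst (2 * m * (m + t) ℕ.≤_) (square m t) (m≤m+n _ (t * t))
  where
  square : ∀ m t → 2 * m * (m + t) + t * t ≡ m * m + (m + t) * (m + t)
  square = solve-∀

2*m*n≤m*m+n*n : ∀ m n → 2 * m * n ℕ.≤ m * m + n * n
2*m*n≤m*m+n*n m n with ≤-total m n
... | inj₁ m≤n = 2*m*n≤m*m+n*n-ordered m≤n
... | inj₂ n≤m = subst₂ ℕ._≤_ (swap m n) (+-comm (n * n) (m * m)) (2*m*n≤m*m+n*n-ordered n≤m)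
  where
  swap : ∀ m n → 2 * n * m ≡ 2 * m * n
  swap = solve-∀

-- The difference of the two sides is (d - k m)².
frac≤tangent-ℕ : ∀ k d m → m * (d * (suc k * suc k)) ℕ.≤ (d + k * k * m) * (m + d)
frac≤tangent-ℕ k d m = +-cancelʳ-≤ (2 * d * (k * m)) _ _
  (subst (lhs + 2 * d * (k * m) ℕ.≤_) (expand k d m) (+-monoʳ-≤ lhs (2*m*n≤m*m+n*n d (k * m))))
  where
  lhs : ℕ
  lhs = m * (d * (suc k * suc k))
  expand : ∀ k d m → m * (d * (suc k * suc k)) + (d * d + k * m * (k * m))
                     ≡ (d + k * k * m) * (m + d) + 2 * d * (k * m)
  expand = solve-∀

/ᵘ-≤ : ∀ a b c e .{{_ : NonZero b}} .{{_ : NonZero e}} → a * e ℕ.≤ c * b → + a /ᵘ b ≤ᵘ + c /ᵘ e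
/ᵘ-≤ a (suc b) c (suc e) le = *≤* (subst₂ ℤ._≤_ (pos-* a (suc e)) (pos-* c (suc b)) (+≤+ le))

/ᵘ-+ : ∀ a c D .{{_ : NonZero D}} → (+ a /ᵘ D) ℚᵘ.+ (+ c /ᵘ D) ≃ + (a + c) /ᵘ D
/ᵘ-+ a c D@(suc _) = *≡* (begin
  (+ a ℤ.* + D ℤ.+ + c ℤ.* + D) ℤ.* + D  ≡⟨ cong (ℤ._* + D) (*-distribʳ-+ (+ D) (+ a) (+ c)) ⟨
  (+ a ℤ.+ + c) ℤ.* + D ℤ.* + D          ≡⟨ *-assoc (+ a ℤ.+ + c) (+ D) (+ D) ⟩
  (+ a ℤ.+ + c) ℤ.* (+ D ℤ.* + D)        ≡⟨ cong₂ ℤ._*_ (pos-+ a c) (pos-* D D) ⟨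
  + (a + c) ℤ.* + (D * D)                ∎)
  where open ≡-Reasoning

sumℚ-≤-/ᵘ : ∀ {A : Set} (q : A → ℚ) (g : A → ℕ) D .{{_ : NonZero D}} →
  (∀ u → toℚᵘ (q u) ≤ᵘ + g u /ᵘ D) → ∀ L → toℚᵘ (sumℚ (map q L)) ≤ᵘ + sum (map g L) /ᵘ D
sumℚ-≤-/ᵘ q g D q≤g [] = /ᵘ-≤ 0 1 0 D z≤n
sumℚ-≤-/ᵘ q g D q≤g (u ∷ L) = begin
  toℚᵘ (q u ℚ.+ sumℚ (map q L))                       ≃⟨ toℚᵘ-homo-+ (q u) (sumℚ (map q L)) ⟩
  toℚᵘ (q u) ℚᵘ.+ toℚᵘ (sumℚ (map q L))               ≤⟨ +-mono-≤ (q≤g u) (sumℚ-≤-/ᵘ q g D q≤g L) ⟩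
  (+ g u /ᵘ D) ℚᵘ.+ (+ sum (map g L) /ᵘ D)            ≃⟨ /ᵘ-+ (g u) (sum (map g L)) D ⟩
  + (g u + sum (map g L)) /ᵘ D                        ∎
  where open ≤-Reasoning

sum-map-affine : ∀ {A : Set} (f : A → ℕ) a b L →
  sum (map (λ u → a + b * f u) L) ≡ length L * a + b * sum (map f L)
sum-map-affine f a b [] = sym (*-zeroʳ b)
sum-map-affine f a b (u ∷ L) = begin
  a + b * f u + sum (map (λ u → a + b * f u) L)  ≡⟨ cong (_+_ (a + b * f u)) (sum-map-affine f a b L) ⟩
  a + b * f u + (length L * a + b * s)           ≡⟨ regroup a b (f u) (length L) s ⟩
  suc (length L) * a + b * (f u + s)             ∎
  where
  open ≡-Reasoning
  s = sum (map f L)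
  regroup : ∀ a b x n s → a + b * x + (n * a + b * s) ≡ (1 + n) * a + b * (x + s)
  regroup = solve-∀

-- The tangent line of x ↦ x / (x + d) at x = d / k, for d = suc d'.
tangent : ℕ → ℕ → ℕ → ℚᵘ
tangent k d' x = + (suc d' + k * k * x) /ᵘ (suc d' * (suc k * suc k))

frac≤tangent : ∀ k d' m → toℚᵘ (frac m (suc d')) ≤ᵘ tangent k d' m
frac≤tangent k d' zero = /ᵘ-≤ 0 1 _ _ z≤n
frac≤tangent k d' m@(suc _) =
  ≤-respˡ-≃ (≃-sym (toℚᵘ-fromℚᵘ (+ m /ᵘ (m + suc d'))))
    (/ᵘ-≤ m (m + suc d') _ _ (frac≤tangent-ℕ k (suc d') m))

sumℚ-frac-of-zeros : ∀ {A : Set} (f : A → ℕ) d L →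
  sum (map f L) ≡ 0 → sumℚ (map (λ u → frac (f u) d) L) ≡ 0ℚ
sumℚ-frac-of-zeros f d [] _ = refl
sumℚ-frac-of-zeros f d (u ∷ L) Σ≡0
  rewrite m+n≡0⇒m≡0 (f u) Σ≡0 | sumℚ-frac-of-zeros f d L (m+n≡0⇒n≡0 (f u) Σ≡0) = refl

sumℚ-frac≤ : ∀ {A : Set} (f : A → ℕ) L →
  sumℚ (map (λ u → frac (f u) (sum (map f L))) L) ≤ + length L / suc (length L)
sumℚ-frac≤ {A} f L with sum (map f L) in Σ≡d
... | zero = subst (_≤ _) (sym (sumℚ-frac-of-zeros f 0 L Σ≡d))
  (nonNegative⁻¹ _ {{normalize-nonNeg (length L) (suc (length L))}})
... | suc d' = toℚᵘ-cancel-≤ (begin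
  toℚᵘ (sumℚ (map (λ u → frac (f u) (suc d')) L))
    ≤⟨ sumℚ-≤-/ᵘ _ numerator D (λ u → frac≤tangent k d' (f u)) L ⟩
  + sum (map numerator L) /ᵘ D
    ≡⟨ cong (λ n → + n /ᵘ D) Σnumerator ⟩
  + (k * suc d' + k * k * suc d') /ᵘ D
    ≤⟨ /ᵘ-≤ _ D k (suc k) (≤-reflexive (cancel k d')) ⟩
  + k /ᵘ suc k
    ≃⟨ toℚᵘ-fromℚᵘ (+ k /ᵘ suc k) ⟨
  toℚᵘ (+ k / suc k) ∎)
  where
  open ≤-Reasoning
  k D : ℕ
  k = length L
  D = suc d' * (suc k * suc k)
  numerator : A → ℕ
  numerator u = suc d' + k * k * f u
  Σnumerator : sum (map numerator L) ≡ k * suc d' + k * k * suc d'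
  Σnumerator = trans (sum-map-affine f (suc d') (k * k) L)
                     (cong (λ s → k * suc d' + k * k * s) Σ≡d)
  cancel : ∀ k d' → (k * suc d' + k * k * suc d') * suc k ≡ k * (suc d' * (suc k * suc k))
  cancel = solve-∀

lemma6p5 : ∀ {n} (G : Multigraph n) (v : Fin n) →
    weightedSum G v ≤ (+ length (N G v)) / suc (length (N G v))
lemma6p5 G v rewrite sym (foldr-map _+_ (λ u → μ G u v) 0 (N G v)) =
  sumℚ-frac≤ (λ u → μ G u v) (N G v)
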